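{- Every signed poset $P$ on $[n]$ is isomorphic to a naturally labeled signed poset; that is, there exists $\omega \in S_n^B$ such that $\omega P$ is a naturally labeled signed poset.
   Context: Let $B_n := \{\pm e_i : 1 \le i \le n\} \cup \{\pm e_i \pm e_j : 1 \le i < j \le n\} \subset \mathbb{R}^n$. For $S \subseteq B_n$, $\mathrm{PLC}(S)$ is the set of elements of $B_n$ that are positive linear combinations of elements of $S$. A signed poset on $[n]$ is a subset $P \subseteq B_n$ with (1) $\alpha \in P \Rightarrow -\alpha \notin P$, (2) $\mathrm{PLC}(P) = P$. $S_n^B$ is the group of bijections $\omega$ of $\{\pm 1,\dots,\pm n\}$ with $\omega(-i) = -\omega(i)$; it acts linearly on $\mathbb{R}^n$ by $\omega e_i = e_j$ if $\omega(i) = j$ and $\omega e_i = -e_j$ if $\omega(i) = -j$, and $\omega P := \{\omega\alpha : \alpha\in P\}$. Two signed posets $P,P'$ are isomorphic if $\omega P = P'$ for some $\omega\in S_n^B$. The Jordan–Hölder set $\mathrm{JH}(P)$ is the set of $\omega \in S_n^B$ such that $\langle (\omega(1),\dots,\omega(n)), \alpha \rangle \ge 0$ for all $\alpha \in P$. $P$ is naturally labeled if the identity of $S_n^B$ lies in $\mathrm{JH}(P)$. -}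

module Defs where

open import Level using (0ℓ)
open import Data.Nat as ℕ using (ℕ; zero; suc)
open import Data.Integer as ℤ using (ℤ; +_; -_; _≥_)
open import Data.Rational as ℚ using (ℚ; Positive; 0ℚ)
open import Data.Fin using (Fin; toℕ)
open import Data.Fin.Permutation using (Permutation′; _⟨$⟩ʳ_; _⟨$⟩ˡ_)
import Data.Fin.Permutation as Perm
open import Data.Vec using (Vec; []; _∷_; lookup; tabulate; map; zipWith; replicate; foldr)
open import Data.List using (List)
import Data.List as List
open import Data.List.Relation.Unary.All using (All)
open import Data.Bool using (Bool; true; false; T)
open import Data.Product using (Σ; _×_; _,_; ∃; ∃-syntax)
open import Data.Sum using (_⊎_)
open import Relation.Unary using (Pred)
open import Relation.Binary.PropositionalEquality using (_≡_; _≢_)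
open import Relation.Nullary using (¬_)

-- Vectors of ℝ^n with integer coordinates (all of B_n lives here).
ZVec : ℕ → Set
ZVec n = Vec ℤ n

e : ∀ {n} → Fin n → ZVec n
e i = tabulate λ j → ZVecCoord i j
  where
  open import Relation.Nullary using (yes; no)
  open import Data.Fin using (_≟_)
  ZVecCoord : ∀ {n} → Fin n → Fin n → ℤ
  ZVecCoord i j with i ≟ j
  ... | yes _ = + 1
  ... | no  _ = + 0

_⊕_ : ∀ {n} → ZVec n → ZVec n → ZVec n
_⊕_ = zipWith ℤ._+_

neg : ∀ {n} → ZVec n → ZVec n
neg = map (-_)

signed : ∀ {n} → Bool → ZVec n → ZVec n
signed true  v = v
signed false v = neg v

data InB {n : ℕ} : ZVec n → Set where
  short : (s : Bool) (i : Fin n) → InB (signed s (e i))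
  long  : (s t : Bool) (i j : Fin n) → toℕ i ℕ.< toℕ j →
          InB (signed s (e i) ⊕ signed t (e j))

-- A subset of (the integer points of) ℝ^n, given by its characteristic
-- function (all subsets of the finite set B_n are decidable classically).
Subset : ℕ → Set
Subset n = ZVec n → Bool

_∈ₛ_ : ∀ {n} → ZVec n → Subset n → Set
α ∈ₛ S = T (S α)

toQ : ∀ {n} → ZVec n → Vec ℚ n
toQ = map (λ z → z ℚ./ 1)

scaleQ : ∀ {n} → ℚ → Vec ℚ n → Vec ℚ n
scaleQ c = map (c ℚ.*_)

lincomb : ∀ {n} → List (ℚ × ZVec n) → Vec ℚ n
lincomb {n} = List.foldr (λ { (c , v) acc → zipWith ℚ._+_ (scaleQ c (toQ v)) acc }) (replicate n 0ℚ)

IsPosLinComb : ∀ {n} → Subset n → ZVec n → Set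
IsPosLinComb S α =
  ∃[ terms ] All (λ { (c , β) → Positive c × β ∈ₛ S }) terms × lincomb terms ≡ toQ α

PLC : ∀ {n} → Subset n → ZVec n → Set
PLC S α = InB α × IsPosLinComb S α

record IsSignedPoset {n : ℕ} (P : Subset n) : Set where
  field
    sub      : ∀ α → α ∈ₛ P → InB α
    antisym  : ∀ α → α ∈ₛ P → ¬ (neg α ∈ₛ P)
    closedˡ  : ∀ α → PLC P α → α ∈ₛ P
    closedʳ  : ∀ α → α ∈ₛ P → PLC P α

-- Signed permutations S_n^B: ω(i) = ε_i · π(i), with π a permutation of [n]
-- and ε_i ∈ {+1 (true), -1 (false)}.
record SignedPerm (n : ℕ) : Set where
  constructor sperm
  field
    perm : Permutation′ n
    sign : Fin n → Bool
open SignedPerm public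

idB : ∀ {n} → SignedPerm n
idB = sperm Perm.id (λ _ → true)

-- Linear action: ω e_i = ε_i e_{π(i)}, so (ω v)_j = ε_{π⁻¹ j} v_{π⁻¹ j}.
signZ : Bool → ℤ → ℤ
signZ true  z = z
signZ false z = - z

act : ∀ {n} → SignedPerm n → ZVec n → ZVec n
act ω v = tabulate λ j → let i = perm ω ⟨$⟩ˡ j in signZ (sign ω i) (lookup v i)

invB : ∀ {n} → SignedPerm n → SignedPerm n
invB ω = sperm (Perm.flip (perm ω)) (λ j → sign ω (perm ω ⟨$⟩ˡ j))

-- ωP = {ωα : α ∈ P}, i.e. γ ∈ ωP iff ω⁻¹γ ∈ P.
actSet : ∀ {n} → SignedPerm n → Subset n → Subset n
actSet ω P γ = P (act (invB ω) γ)

-- The value ω(i) ∈ {±1,…,±n} as an integer (i ∈ Fin n stands for i+1).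
value : ∀ {n} → SignedPerm n → Fin n → ℤ
value ω i = signZ (sign ω i) (+ suc (toℕ (perm ω ⟨$⟩ʳ i)))

dot : ∀ {n} → Vec ℤ n → Vec ℤ n → ℤ
dot u v = foldr _ ℤ._+_ (+ 0) (zipWith ℤ._*_ u v)

InJH : ∀ {n} → Subset n → SignedPerm n → Set
InJH P ω = ∀ α → α ∈ₛ P → dot (tabulate (value ω)) α ≥ + 0

NaturallyLabeled : ∀ {n} → Subset n → Set
NaturallyLabeled P = InJH P idB

-- Signed indices ±i are the unit vectors ±e_i, and a signed poset Q orders them by
-- x < y iff Q contains a positive multiple of y - x; closure under positive linear
-- combinations makes this a strict partial order.  For m = n-1, …, 0, pick a maximal
-- signed index x among those at positions ≤ m and apply the signed permutation sending
-- x to +e_m, which fixes all positions above m.  By maximality, no element of Q supported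
-- on positions ≤ m has coefficient -1 at position m afterwards.  In the end every element
-- of Q has its last nonzero coordinate equal to +1, and such roots, e_j and ±e_i + e_j with
-- i < j, pair nonnegatively with (1, …, n).

module Submission where

open import Defs
open import Data.Nat as ℕ using (ℕ; zero; suc)
import Data.Nat.Properties as ℕP
open import Data.Integer as ℤ using (ℤ; +_; -[1+_]; _+_; _*_; -_; _-_)
import Data.Integer.Properties as ℤP
open import Data.Integer.Solver using (module +-*-Solver)
open import Data.Rational as ℚ using (ℚ; 0ℚ; 1ℚ; ½; Positive)
import Data.Rational.Properties as ℚP
open import Data.Rational.Literals using (fromℤ)
open import Data.Fin as F using (Fin; toℕ; _≟_)
import Data.Fin.Properties as FP
open import Data.Fin.Permutation using (Permutation′; _⟨$⟩ʳ_; _⟨$⟩ˡ_)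
import Data.Fin.Permutation as Perm
open import Data.Vec using (Vec; []; _∷_; lookup; tabulate; tail; zipWith)
open import Data.Vec.Properties using (lookup∘tabulate; lookup-map; lookup-zipWith; lookup-replicate)
open import Data.Vec.Relation.Binary.Pointwise.Extensional using (ext; Pointwise-≡⇒≡)
open import Data.List as List using (List; []; _∷_)
open import Data.List.Relation.Unary.All as All using (All; []; _∷_)
open import Data.List.Relation.Unary.All.Properties using (map⁺)
open import Data.List.Relation.Unary.Any using (here; there)
open import Data.List.Membership.Propositional using (_∈_)
open import Data.List.Membership.Propositional.Properties using (∈-cartesianProduct⁺; ∈-allFin)
open import Data.Bool as Bool using (Bool; true; false; not; if_then_else_)
open import Data.Bool.Properties using (¬-not; not-¬; not-involutive)
open import Data.Product using (_×_; _,_; proj₁; proj₂; map₂; ∃-syntax)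
open import Data.Product.Properties using (≡-dec)
open import Data.Sum using (_⊎_; inj₁; inj₂; [_,_]′)
open import Data.Empty using (⊥)
open import Relation.Nullary using (¬_; Dec; yes; no; does; contradiction)
open import Function using (_∋_)
open import Relation.Nullary.Decidable using (dec-true; dec-false; _×-dec_; ¬?; T?)
open import Relation.Binary using (tri<; tri≈; tri>)
open import Relation.Binary.PropositionalEquality
open ≡-Reasoning

≡-from-lookup : ∀ {A : Set} {n} {u v : Vec A n} → (∀ k → lookup u k ≡ lookup v k) → u ≡ v
≡-from-lookup h = Pointwise-≡⇒≡ (ext h)

signZ-involutive : ∀ s z → signZ s (signZ s z) ≡ z
signZ-involutive true  z = refl
signZ-involutive false z = ℤP.neg-involutive z

signZ-+ : ∀ s x y → signZ s (x + y) ≡ signZ s x + signZ s y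
signZ-+ true  x y = refl
signZ-+ false x y = ℤP.neg-distrib-+ x y

signZ-neg : ∀ s z → signZ s (- z) ≡ - signZ s z
signZ-neg true  z = refl
signZ-neg false z = refl

signZ-0 : ∀ s → signZ s (+ 0) ≡ + 0
signZ-0 true  = refl
signZ-0 false = refl

signZ-not : ∀ s z → signZ (not s) z ≡ - signZ s z
signZ-not true  z = refl
signZ-not false z = sym (ℤP.neg-involutive z)

signZ-≢0 : ∀ s → signZ s (+ 1) ≢ + 0
signZ-≢0 true  ()
signZ-≢0 false ()

signZ-injective : ∀ {s t} → signZ s (+ 1) ≡ signZ t (+ 1) → s ≡ t
signZ-injective {true}  {true}  _ = refl
signZ-injective {false} {false} _ = refl
signZ-injective {true}  {false} ()
signZ-injective {false} {true}  ()

infixl 7 _⊙_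
_⊙_ : Bool → Bool → Bool
true  ⊙ b = b
false ⊙ b = not b

signZ-⊙ : ∀ a b z → signZ (a ⊙ b) z ≡ signZ a (signZ b z)
signZ-⊙ true  b     z = refl
signZ-⊙ false true  z = refl
signZ-⊙ false false z = sym (ℤP.neg-involutive z)

lookup-⊕ : ∀ {n} (u v : ZVec n) k → lookup (u ⊕ v) k ≡ lookup u k + lookup v k
lookup-⊕ u v k = lookup-zipWith _+_ k u v

lookup-neg : ∀ {n} (v : ZVec n) k → lookup (neg v) k ≡ - lookup v k
lookup-neg v k = lookup-map k -_ v

lookup-signed : ∀ {n} s (v : ZVec n) k → lookup (signed s v) k ≡ signZ s (lookup v k)
lookup-signed true  v k = refl
lookup-signed false v k = lookup-neg v k

-- The coordinate function of e is local to Defs, so lookup∘tabulate is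
-- instantiated by unification against the ascribed equation.
lookup-e-same : ∀ {n} (i : Fin n) → lookup (e i) i ≡ + 1
lookup-e-same i rewrite (lookup (e i) i ≡ _) ∋ lookup∘tabulate _ i with i ≟ i
... | yes _   = refl
... | no  i≢i = contradiction refl i≢i

lookup-e-other : ∀ {n} {i k : Fin n} → i ≢ k → lookup (e i) k ≡ + 0
lookup-e-other {i = i} {k} i≢k rewrite (lookup (e i) k ≡ _) ∋ lookup∘tabulate _ k with i ≟ k
... | yes i≡k = contradiction i≡k i≢k
... | no  _   = refl

⊕-comm : ∀ {n} (u v : ZVec n) → u ⊕ v ≡ v ⊕ u
⊕-comm u v = ≡-from-lookup λ k → begin
  lookup (u ⊕ v) k         ≡⟨ lookup-⊕ u v k ⟩
  lookup u k + lookup v k  ≡⟨ ℤP.+-comm (lookup u k) (lookup v k) ⟩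
  lookup v k + lookup u k  ≡⟨ lookup-⊕ v u k ⟨
  lookup (v ⊕ u) k         ∎

neg-⊕ : ∀ {n} (u v : ZVec n) → neg (u ⊕ v) ≡ neg u ⊕ neg v
neg-⊕ u v = ≡-from-lookup λ k → begin
  lookup (neg (u ⊕ v)) k               ≡⟨ lookup-neg (u ⊕ v) k ⟩
  - lookup (u ⊕ v) k                   ≡⟨ cong -_ (lookup-⊕ u v k) ⟩
  - (lookup u k + lookup v k)          ≡⟨ ℤP.neg-distrib-+ (lookup u k) (lookup v k) ⟩
  - lookup u k + - lookup v k          ≡⟨ cong₂ _+_ (lookup-neg u k) (lookup-neg v k) ⟨
  lookup (neg u) k + lookup (neg v) k  ≡⟨ lookup-⊕ (neg u) (neg v) k ⟨
  lookup (neg u ⊕ neg v) k             ∎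

-- Signed indices and the roots of B_n

SignedIndex : ℕ → Set
SignedIndex n = Fin n × Bool

unit : ∀ {n} → SignedIndex n → ZVec n
unit (i , s) = signed s (e i)

lookup-unit-same : ∀ {n} (i : Fin n) s → lookup (unit (i , s)) i ≡ signZ s (+ 1)
lookup-unit-same i s = trans (lookup-signed s (e i) i) (cong (signZ s) (lookup-e-same i))

lookup-unit-other : ∀ {n} {i k : Fin n} s → i ≢ k → lookup (unit (i , s)) k ≡ + 0
lookup-unit-other {i = i} {k} s i≢k =
  trans (lookup-signed s (e i) k) (trans (cong (signZ s) (lookup-e-other i≢k)) (signZ-0 s))

lookup-unit-not : ∀ {n} (i : Fin n) s k → lookup (unit (i , not s)) k ≡ - lookup (unit (i , s)) k
lookup-unit-not i s k = begin
  lookup (unit (i , not s)) k     ≡⟨ lookup-signed (not s) (e i) k ⟩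
  signZ (not s) (lookup (e i) k)  ≡⟨ signZ-not s (lookup (e i) k) ⟩
  - signZ s (lookup (e i) k)      ≡⟨ cong -_ (lookup-signed s (e i) k) ⟨
  - lookup (unit (i , s)) k       ∎

neg-unit : ∀ {n} (i : Fin n) s → neg (unit (i , s)) ≡ unit (i , not s)
neg-unit i s = ≡-from-lookup λ k → trans (lookup-neg (unit (i , s)) k) (sym (lookup-unit-not i s k))

lookup-pair-fst : ∀ {n} {i j : Fin n} s t → i ≢ j → lookup (unit (i , s) ⊕ unit (j , t)) i ≡ signZ s (+ 1)
lookup-pair-fst {i = i} {j} s t i≢j = begin
  lookup (unit (i , s) ⊕ unit (j , t)) i             ≡⟨ lookup-⊕ (unit (i , s)) (unit (j , t)) i ⟩
  lookup (unit (i , s)) i + lookup (unit (j , t)) i  ≡⟨ cong₂ _+_ (lookup-unit-same i s) (lookup-unit-other t (λ j≡i → i≢j (sym j≡i))) ⟩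
  signZ s (+ 1) + + 0                                ≡⟨ ℤP.+-identityʳ _ ⟩
  signZ s (+ 1)                                      ∎

lookup-pair-snd : ∀ {n} {i j : Fin n} s t → i ≢ j → lookup (unit (i , s) ⊕ unit (j , t)) j ≡ signZ t (+ 1)
lookup-pair-snd {i = i} {j} s t i≢j = begin
  lookup (unit (i , s) ⊕ unit (j , t)) j  ≡⟨ cong (λ v → lookup v j) (⊕-comm (unit (i , s)) (unit (j , t))) ⟩
  lookup (unit (j , t) ⊕ unit (i , s)) j  ≡⟨ lookup-pair-fst t s (λ j≡i → i≢j (sym j≡i)) ⟩
  signZ t (+ 1)                           ∎

InB-coordinate : ∀ {n} {α : ZVec n} → InB α → ∀ k → lookup α k ≡ + 0 ⊎ ∃[ b ] lookup α k ≡ signZ b (+ 1)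
InB-coordinate (short s i) k with i ≟ k
... | yes refl = inj₂ (s , lookup-unit-same i s)
... | no  i≢k  = inj₁ (lookup-unit-other s i≢k)
InB-coordinate (long s t i j i<j) k rewrite lookup-⊕ (unit (i , s)) (unit (j , t)) k with i ≟ k | j ≟ k
... | yes refl | yes refl = contradiction i<j (ℕP.<-irrefl refl)
... | yes refl | no  j≢k  =
  inj₂ (s , trans (cong₂ _+_ (lookup-unit-same i s) (lookup-unit-other t j≢k)) (ℤP.+-identityʳ _))
... | no  i≢k  | yes refl =
  inj₂ (t , trans (cong₂ _+_ (lookup-unit-other s i≢k) (lookup-unit-same j t)) (ℤP.+-identityˡ _))
... | no  i≢k  | no  j≢k  = inj₁ (cong₂ _+_ (lookup-unit-other s i≢k) (lookup-unit-other t j≢k))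

InB-pair : ∀ {n} {i j : Fin n} s t → i ≢ j → InB (unit (i , s) ⊕ unit (j , t))
InB-pair {i = i} {j} s t i≢j with ℕP.<-cmp (toℕ i) (toℕ j)
... | tri< i<j _ _ = long s t i j i<j
... | tri≈ _ i≡j _ = contradiction (FP.toℕ-injective i≡j) i≢j
... | tri> _ _ j<i = subst InB (⊕-comm (unit (j , t)) (unit (i , s))) (long t s j i j<i)

-- For x ≢ y, root x y is the element of B_n on the ray through unit x - unit y:
-- that difference itself, or half of it when x and y sit at the same position.
root : ∀ {n} → SignedIndex n → SignedIndex n → ZVec n
root (i , s) (j , t) = if does (i ≟ j) then unit (i , s) else unit (i , s) ⊕ unit (j , not t)

multiplicity : ∀ {n} → SignedIndex n → SignedIndex n → ℤ
multiplicity (i , _) (j , _) = if does (i ≟ j) then + 2 else + 1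

root-same-index : ∀ {n} (i : Fin n) s t → root (i , s) (i , t) ≡ unit (i , s)
root-same-index i s t rewrite dec-true (i ≟ i) refl = refl

root-other-index : ∀ {n} {i j : Fin n} s t → i ≢ j → root (i , s) (j , t) ≡ unit (i , s) ⊕ unit (j , not t)
root-other-index {i = i} {j} s t i≢j rewrite dec-false (i ≟ j) i≢j = refl

multiplicity-same : ∀ {n} {i j : Fin n} s t → i ≡ j → multiplicity (i , s) (j , t) ≡ + 2
multiplicity-same {i = i} s t refl rewrite dec-true (i ≟ i) refl = refl

multiplicity-other : ∀ {n} {i j : Fin n} s t → i ≢ j → multiplicity (i , s) (j , t) ≡ + 1
multiplicity-other {i = i} {j} s t i≢j rewrite dec-false (i ≟ j) i≢j = refl

InB-root : ∀ {n} {x y : SignedIndex n} → x ≢ y → InB (root x y)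
InB-root {x = i , s} {j , t} x≢y with i ≟ j
... | yes refl = short s i
... | no  i≢j  = InB-pair s (not t) i≢j

neg-root : ∀ {n} {x y : SignedIndex n} → x ≢ y → neg (root x y) ≡ root y x
neg-root {x = i , s} {j , t} x≢y with i ≟ j
... | yes refl = begin
  neg (unit (i , s))    ≡⟨ neg-unit i s ⟩
  unit (i , not s)      ≡⟨ cong (λ b → unit (i , b)) (¬-not λ s≡t → x≢y (cong (i ,_) (sym s≡t))) ⟨
  unit (i , t)          ≡⟨ root-same-index i t s ⟨
  root (i , t) (i , s)  ∎
... | no i≢j = begin
  neg (unit (i , s) ⊕ unit (j , not t))        ≡⟨ neg-⊕ (unit (i , s)) (unit (j , not t)) ⟩
  neg (unit (i , s)) ⊕ neg (unit (j , not t))  ≡⟨ cong₂ _⊕_ (neg-unit i s) (neg-unit j (not t)) ⟩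
  unit (i , not s) ⊕ unit (j , not (not t))    ≡⟨ cong (λ b → unit (i , not s) ⊕ unit (j , b)) (not-involutive t) ⟩
  unit (i , not s) ⊕ unit (j , t)              ≡⟨ ⊕-comm (unit (i , not s)) (unit (j , t)) ⟩
  unit (j , t) ⊕ unit (i , not s)              ≡⟨ root-other-index t s (λ j≡i → i≢j (sym j≡i)) ⟨
  root (j , t) (i , s)                         ∎

root-scaled : ∀ {n} {x y : SignedIndex n} → x ≢ y → ∀ k →
  multiplicity x y * lookup (root x y) k ≡ lookup (unit x) k - lookup (unit y) k
root-scaled {x = i , s} {j , t} x≢y k with i ≟ j
... | yes refl = begin
  + 2 * a                          ≡⟨ solve 1 (λ a → con (+ 2) :* a := a :- (:- a)) refl a ⟩
  a - - a                          ≡⟨ cong (λ z → a - z) (lookup-unit-not i s k) ⟨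
  a - lookup (unit (i , not s)) k  ≡⟨ cong (λ t → a - lookup (unit (i , t)) k) t≡not-s ⟨
  a - lookup (unit (i , t)) k      ∎
  where
  open +-*-Solver
  a = lookup (unit (i , s)) k
  t≡not-s : t ≡ not s
  t≡not-s = ¬-not λ t≡s → x≢y (cong (i ,_) (sym t≡s))
... | no  _ = begin
  + 1 * lookup (unit (i , s) ⊕ unit (j , not t)) k       ≡⟨ ℤP.*-identityˡ _ ⟩
  lookup (unit (i , s) ⊕ unit (j , not t)) k             ≡⟨ lookup-⊕ (unit (i , s)) (unit (j , not t)) k ⟩
  lookup (unit (i , s)) k + lookup (unit (j , not t)) k  ≡⟨ cong (λ z → lookup (unit (i , s)) k + z) (lookup-unit-not j t k) ⟩
  lookup (unit (i , s)) k - lookup (unit (j , t)) k      ∎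

root-chain : ∀ {n} {x y z : SignedIndex n} → x ≢ y → y ≢ z → x ≢ z → ∀ k →
  multiplicity x z * lookup (root x z) k ≡ multiplicity x y * lookup (root x y) k + multiplicity y z * lookup (root y z) k
root-chain {x = x} {y} {z} x≢y y≢z x≢z k = begin
  multiplicity x z * lookup (root x z) k
    ≡⟨ root-scaled x≢z k ⟩
  ux - uz
    ≡⟨ solve 3 (λ a b c → a :- c := (a :- b) :+ (b :- c)) refl ux uy uz ⟩
  (ux - uy) + (uy - uz)
    ≡⟨ cong₂ _+_ (root-scaled x≢y k) (root-scaled y≢z k) ⟨
  multiplicity x y * lookup (root x y) k + multiplicity y z * lookup (root y z) k  ∎
  where
  open +-*-Solver
  ux = lookup (unit x) k
  uy = lookup (unit y) k
  uz = lookup (unit z) k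

no-three-signs-at-one-position : ∀ {n} {i j k : Fin n} {s t r} → i ≡ k → j ≡ i →
  (i , s) ≢ (j , t) → (j , t) ≢ (k , r) → (i , s) ≢ (k , r) → ⊥
no-three-signs-at-one-position {i = i} {s = s} {t} {r} refl refl x≢y y≢z x≢z =
  s≢r (trans (¬-not s≢t) (trans (cong not (¬-not t≢r)) (not-involutive r)))
  where
  s≢t : s ≢ t
  s≢t s≡t = x≢y (cong (i ,_) s≡t)
  t≢r : t ≢ r
  t≢r t≡r = y≢z (cong (i ,_) t≡r)
  s≢r : s ≢ r
  s≢r s≡r = x≢z (cong (i ,_) s≡r)

root-through : ∀ {n} {α : ZVec n} → InB α → ∀ i s → lookup α i ≡ signZ (not s) (+ 1) →
  ∃[ y ] y ≢ (i , s) × root y (i , s) ≡ α × lookup α (proj₁ y) ≢ + 0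
root-through (short b j) i s αi≡-s with j ≟ i
... | no j≢i = contradiction (trans (sym (lookup-unit-other b j≢i)) αi≡-s) (λ 0≡-s → signZ-≢0 (not s) (sym 0≡-s))
... | yes refl = (j , b) , y≢x , root-same-index j b s , λ αj≡0 → signZ-≢0 b (trans (sym (lookup-unit-same j b)) αj≡0)
  where
  y≢x : (j , b) ≢ (j , s)
  y≢x y≡x = not-¬ (cong proj₂ y≡x) (signZ-injective (trans (sym (lookup-unit-same j b)) αi≡-s))
root-through (long b t j l j<l) i s αi≡-s with j ≟ i | l ≟ i
... | yes refl | yes refl = contradiction j<l (ℕP.<-irrefl refl)
... | yes refl | no  l≢j = (l , t) , (λ y≡x → l≢j (cong proj₁ y≡x)) , root≡α ,
                             λ αl≡0 → signZ-≢0 t (trans (sym (lookup-pair-snd b t j≢l)) αl≡0)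
  where
  j≢l : j ≢ l
  j≢l j≡l = l≢j (sym j≡l)
  b≡not-s : b ≡ not s
  b≡not-s = signZ-injective (trans (sym (lookup-pair-fst b t j≢l)) αi≡-s)
  root≡α : root (l , t) (j , s) ≡ unit (j , b) ⊕ unit (l , t)
  root≡α = begin
    root (l , t) (j , s)             ≡⟨ root-other-index t s l≢j ⟩
    unit (l , t) ⊕ unit (j , not s)  ≡⟨ cong (λ c → unit (l , t) ⊕ unit (j , c)) b≡not-s ⟨
    unit (l , t) ⊕ unit (j , b)      ≡⟨ ⊕-comm (unit (l , t)) (unit (j , b)) ⟩
    unit (j , b) ⊕ unit (l , t)      ∎
... | no  j≢l  | yes refl = (j , b) , (λ y≡x → j≢l (cong proj₁ y≡x)) , root≡α ,
                             λ αj≡0 → signZ-≢0 b (trans (sym (lookup-pair-fst b t j≢l)) αj≡0)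
  where
  t≡not-s : t ≡ not s
  t≡not-s = signZ-injective (trans (sym (lookup-pair-snd b t j≢l)) αi≡-s)
  root≡α : root (j , b) (l , s) ≡ unit (j , b) ⊕ unit (l , t)
  root≡α = trans (root-other-index b s j≢l) (cong (λ c → unit (j , b) ⊕ unit (l , c)) (sym t≡not-s))
... | no  j≢i  | no  l≢i = contradiction αi≡0 λ αi≡0 → signZ-≢0 (not s) (trans (sym αi≡-s) αi≡0)
  where
  αi≡0 : lookup (unit (j , b) ⊕ unit (l , t)) i ≡ + 0
  αi≡0 = trans (lookup-⊕ (unit (j , b)) (unit (l , t)) i) (cong₂ _+_ (lookup-unit-other b j≢i) (lookup-unit-other t l≢i))

allSignedIndices : ∀ n → List (SignedIndex n)
allSignedIndices n = List.cartesianProduct (List.allFin n) (true ∷ false ∷ [])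

∈-allSignedIndices : ∀ {n} (x : SignedIndex n) → x ∈ allSignedIndices n
∈-allSignedIndices (i , true)  = ∈-cartesianProduct⁺ (∈-allFin i) (here refl)
∈-allSignedIndices (i , false) = ∈-cartesianProduct⁺ (∈-allFin i) (there (here refl))

-- The action of S_n^B

⟨$⟩ʳ-injective : ∀ {n} (π : Permutation′ n) {i j} → π ⟨$⟩ʳ i ≡ π ⟨$⟩ʳ j → i ≡ j
⟨$⟩ʳ-injective π πi≡πj = trans (sym (Perm.inverseˡ π)) (trans (cong (π ⟨$⟩ˡ_) πi≡πj) (Perm.inverseˡ π))

actIndex : ∀ {n} → SignedPerm n → SignedIndex n → SignedIndex n
actIndex ω (i , s) = perm ω ⟨$⟩ʳ i , sign ω i ⊙ s

lookup-act : ∀ {n} (ω : SignedPerm n) v j →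
  lookup (act ω v) j ≡ signZ (sign ω (perm ω ⟨$⟩ˡ j)) (lookup v (perm ω ⟨$⟩ˡ j))
lookup-act ω v j = lookup∘tabulate _ j

lookup-act-inv : ∀ {n} (ω : SignedPerm n) v i →
  lookup (act (invB ω) v) i ≡ signZ (sign ω i) (lookup v (perm ω ⟨$⟩ʳ i))
lookup-act-inv ω v i = begin
  lookup (act (invB ω) v) i
    ≡⟨ lookup-act (invB ω) v i ⟩
  signZ (sign ω (perm ω ⟨$⟩ˡ (perm ω ⟨$⟩ʳ i))) (lookup v (perm ω ⟨$⟩ʳ i))
    ≡⟨ cong (λ k → signZ (sign ω k) (lookup v (perm ω ⟨$⟩ʳ i))) (Perm.inverseˡ (perm ω)) ⟩
  signZ (sign ω i) (lookup v (perm ω ⟨$⟩ʳ i))  ∎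

act-⊕ : ∀ {n} (ω : SignedPerm n) u v → act ω (u ⊕ v) ≡ act ω u ⊕ act ω v
act-⊕ ω u v = ≡-from-lookup λ j → let i = perm ω ⟨$⟩ˡ j ; ε = sign ω i in begin
  lookup (act ω (u ⊕ v)) j                     ≡⟨ lookup-act ω (u ⊕ v) j ⟩
  signZ ε (lookup (u ⊕ v) i)                   ≡⟨ cong (signZ ε) (lookup-⊕ u v i) ⟩
  signZ ε (lookup u i + lookup v i)            ≡⟨ signZ-+ ε (lookup u i) (lookup v i) ⟩
  signZ ε (lookup u i) + signZ ε (lookup v i)  ≡⟨ cong₂ _+_ (lookup-act ω u j) (lookup-act ω v j) ⟨
  lookup (act ω u) j + lookup (act ω v) j      ≡⟨ lookup-⊕ (act ω u) (act ω v) j ⟨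
  lookup (act ω u ⊕ act ω v) j                 ∎

act-neg : ∀ {n} (ω : SignedPerm n) v → act ω (neg v) ≡ neg (act ω v)
act-neg ω v = ≡-from-lookup λ j → let i = perm ω ⟨$⟩ˡ j ; ε = sign ω i in begin
  lookup (act ω (neg v)) j    ≡⟨ lookup-act ω (neg v) j ⟩
  signZ ε (lookup (neg v) i)  ≡⟨ cong (signZ ε) (lookup-neg v i) ⟩
  signZ ε (- lookup v i)      ≡⟨ signZ-neg ε (lookup v i) ⟩
  - signZ ε (lookup v i)      ≡⟨ cong -_ (lookup-act ω v j) ⟨
  - lookup (act ω v) j        ≡⟨ lookup-neg (act ω v) j ⟨
  lookup (neg (act ω v)) j    ∎

act-act-inv : ∀ {n} (ω : SignedPerm n) γ → act ω (act (invB ω) γ) ≡ γ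
act-act-inv ω γ = ≡-from-lookup λ j → let i = perm ω ⟨$⟩ˡ j ; ε = sign ω i in begin
  lookup (act ω (act (invB ω) γ)) j             ≡⟨ lookup-act ω (act (invB ω) γ) j ⟩
  signZ ε (lookup (act (invB ω) γ) i)           ≡⟨ cong (signZ ε) (lookup-act-inv ω γ i) ⟩
  signZ ε (signZ ε (lookup γ (perm ω ⟨$⟩ʳ i)))  ≡⟨ signZ-involutive ε _ ⟩
  lookup γ (perm ω ⟨$⟩ʳ i)                      ≡⟨ cong (lookup γ) (Perm.inverseʳ (perm ω)) ⟩
  lookup γ j                                    ∎

act-unit : ∀ {n} (ω : SignedPerm n) x → act ω (unit x) ≡ unit (actIndex ω x)
act-unit ω (i , s) = ≡-from-lookup coordinate
  where
  coordinate : ∀ j → lookup (act ω (unit (i , s))) j ≡ lookup (unit (actIndex ω (i , s))) j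
  coordinate j rewrite lookup-act ω (unit (i , s)) j with i ≟ perm ω ⟨$⟩ˡ j
  ... | yes refl rewrite Perm.inverseʳ (perm ω) {j} = begin
    signZ (sign ω i) (lookup (unit (i , s)) i)  ≡⟨ cong (signZ (sign ω i)) (lookup-unit-same i s) ⟩
    signZ (sign ω i) (signZ s (+ 1))            ≡⟨ signZ-⊙ (sign ω i) s (+ 1) ⟨
    signZ (sign ω i ⊙ s) (+ 1)                  ≡⟨ lookup-unit-same j (sign ω i ⊙ s) ⟨
    lookup (unit (j , sign ω i ⊙ s)) j          ∎
  ... | no i≢π⁻¹j = begin
    signZ ε (lookup (unit (i , s)) (perm ω ⟨$⟩ˡ j))  ≡⟨ cong (signZ ε) (lookup-unit-other s i≢π⁻¹j) ⟩
    signZ ε (+ 0)                                    ≡⟨ signZ-0 ε ⟩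
    + 0                                              ≡⟨ lookup-unit-other (sign ω i ⊙ s) πi≢j ⟨
    lookup (unit (actIndex ω (i , s))) j             ∎
    where
    ε = sign ω (perm ω ⟨$⟩ˡ j)
    πi≢j : perm ω ⟨$⟩ʳ i ≢ j
    πi≢j πi≡j = i≢π⁻¹j (trans (sym (Perm.inverseˡ (perm ω))) (cong (perm ω ⟨$⟩ˡ_) πi≡j))

act-InB : ∀ {n} (ω : SignedPerm n) {α} → InB α → InB (act ω α)
act-InB ω (short s i) = subst InB (sym (act-unit ω (i , s))) (short (sign ω i ⊙ s) (perm ω ⟨$⟩ʳ i))
act-InB ω (long s t i j i<j) = subst InB (sym act-root) (InB-pair (sign ω i ⊙ s) (sign ω j ⊙ t) πi≢πj)
  where
  act-root : act ω (unit (i , s) ⊕ unit (j , t)) ≡ unit (actIndex ω (i , s)) ⊕ unit (actIndex ω (j , t))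
  act-root = trans (act-⊕ ω (unit (i , s)) (unit (j , t))) (cong₂ _⊕_ (act-unit ω (i , s)) (act-unit ω (j , t)))
  πi≢πj : perm ω ⟨$⟩ʳ i ≢ perm ω ⟨$⟩ʳ j
  πi≢πj πi≡πj = ℕP.<-irrefl (cong toℕ (⟨$⟩ʳ-injective (perm ω) πi≡πj)) i<j

infixr 9 _∘B_
_∘B_ : ∀ {n} → SignedPerm n → SignedPerm n → SignedPerm n
τ ∘B ω = sperm (perm ω Perm.∘ₚ perm τ) (λ i → sign ω i ⊙ sign τ (perm ω ⟨$⟩ʳ i))

act-inv-∘B : ∀ {n} (τ ω : SignedPerm n) γ → act (invB (τ ∘B ω)) γ ≡ act (invB ω) (act (invB τ) γ)
act-inv-∘B τ ω γ = ≡-from-lookup λ i → let j = perm ω ⟨$⟩ʳ i in begin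
  lookup (act (invB (τ ∘B ω)) γ) i                                ≡⟨ lookup-act-inv (τ ∘B ω) γ i ⟩
  signZ (sign ω i ⊙ sign τ j) (lookup γ (perm τ ⟨$⟩ʳ j))          ≡⟨ signZ-⊙ (sign ω i) (sign τ j) _ ⟩
  signZ (sign ω i) (signZ (sign τ j) (lookup γ (perm τ ⟨$⟩ʳ j)))  ≡⟨ cong (signZ (sign ω i)) (lookup-act-inv τ γ j) ⟨
  signZ (sign ω i) (lookup (act (invB τ) γ) j)                    ≡⟨ lookup-act-inv ω (act (invB τ) γ) i ⟨
  lookup (act (invB ω) (act (invB τ) γ)) i                        ∎

moveTo : ∀ {n} → SignedIndex n → Fin n → SignedPerm n
moveTo (i , s) j = sperm (Perm.transpose i j) (λ k → if does (k ≟ i) then s else true)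

lookup-moveTo-index : ∀ {n} (i : Fin n) s j β → lookup (act (invB (moveTo (i , s) j)) β) i ≡ signZ s (lookup β j)
lookup-moveTo-index i s j β rewrite lookup-act-inv (moveTo (i , s) j) β i | dec-true (i ≟ i) refl = refl

lookup-moveTo-other : ∀ {n} {i j k : Fin n} s β → k ≢ i → k ≢ j → lookup (act (invB (moveTo (i , s) j)) β) k ≡ lookup β k
lookup-moveTo-other {i = i} {j} {k} s β k≢i k≢j
  rewrite lookup-act-inv (moveTo (i , s) j) β k | dec-false (k ≟ i) k≢i | dec-false (k ≟ j) k≢j = refl

ι : ℤ → ℚ
ι z = z ℚ./ 1

ι≡fromℤ : ∀ z → ι z ≡ fromℤ z
ι≡fromℤ z = ℚP.↥p/↧p≡p (fromℤ z)

ι-+ : ∀ a b → ι (a + b) ≡ ι a ℚ.+ ι b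
ι-+ a b rewrite ι≡fromℤ a | ι≡fromℤ b =
  ℚP./-cong (cong₂ _+_ (sym (ℤP.*-identityʳ a)) (sym (ℤP.*-identityʳ b))) refl

ι-* : ∀ a b → ι (a * b) ≡ ι a ℚ.* ι b
ι-* a b rewrite ι≡fromℤ a | ι≡fromℤ b = refl

ι-neg : ∀ a → ι (- a) ≡ ℚ.- ι a
ι-neg a = trans (ι≡fromℤ (- a)) (trans (fromℤ-neg a) (cong ℚ.-_ (sym (ι≡fromℤ a))))
  where
  fromℤ-neg : ∀ a → fromℤ (- a) ≡ ℚ.- fromℤ a
  fromℤ-neg (+ zero)   = refl
  fromℤ-neg (+ suc _)  = refl
  fromℤ-neg -[1+ _ ]   = refl

ι-midpoint : ∀ a b c → + 2 * c ≡ a + b → ι c ≡ ½ ℚ.* ι a ℚ.+ ½ ℚ.* ι b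
ι-midpoint a b c 2c≡a+b = begin
  ι c                      ≡⟨ ℚP.*-identityˡ (ι c) ⟨
  1ℚ ℚ.* ι c               ≡⟨ ℚP.*-assoc ½ (ι (+ 2)) (ι c) ⟩
  ½ ℚ.* (ι (+ 2) ℚ.* ι c)  ≡⟨ cong (½ ℚ.*_) (ι-* (+ 2) c) ⟨
  ½ ℚ.* ι (+ 2 * c)        ≡⟨ cong (λ z → ½ ℚ.* ι z) 2c≡a+b ⟩
  ½ ℚ.* ι (a + b)          ≡⟨ cong (½ ℚ.*_) (ι-+ a b) ⟩
  ½ ℚ.* (ι a ℚ.+ ι b)      ≡⟨ ℚP.*-distribˡ-+ ½ (ι a) (ι b) ⟩
  ½ ℚ.* ι a ℚ.+ ½ ℚ.* ι b  ∎

multiplicity-positive : ∀ {n} (x y : SignedIndex n) → Positive (ι (multiplicity x y))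
multiplicity-positive (i , _) (j , _) with i ≟ j
... | yes _ = _
... | no  _ = _

signQ : Bool → ℚ → ℚ
signQ true  q = q
signQ false q = ℚ.- q

ι-signZ : ∀ s z → ι (signZ s z) ≡ signQ s (ι z)
ι-signZ true  z = refl
ι-signZ false z = ι-neg z

signQ-*ʳ : ∀ s c q → c ℚ.* signQ s q ≡ signQ s (c ℚ.* q)
signQ-*ʳ true  c q = refl
signQ-*ʳ false c q = sym (ℚP.neg-distribʳ-* c q)

signQ-+ : ∀ s p q → signQ s (p ℚ.+ q) ≡ signQ s p ℚ.+ signQ s q
signQ-+ true  p q = refl
signQ-+ false p q = ℚP.neg-distrib-+ p q

signQ-0 : ∀ s → signQ s 0ℚ ≡ 0ℚ
signQ-0 true  = refl
signQ-0 false = refl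

lookup-toQ : ∀ {n} (v : ZVec n) k → lookup (toQ v) k ≡ ι (lookup v k)
lookup-toQ v k = lookup-map k ι v

lookup-lincomb-[] : ∀ {n} (k : Fin n) → lookup (lincomb []) k ≡ 0ℚ
lookup-lincomb-[] k = lookup-replicate k 0ℚ

lookup-lincomb-∷ : ∀ {n} c (β : ZVec n) ts k →
  lookup (lincomb ((c , β) ∷ ts)) k ≡ c ℚ.* ι (lookup β k) ℚ.+ lookup (lincomb ts) k
lookup-lincomb-∷ c β ts k = begin
  lookup (zipWith ℚ._+_ (scaleQ c (toQ β)) (lincomb ts)) k
    ≡⟨ lookup-zipWith ℚ._+_ k (scaleQ c (toQ β)) (lincomb ts) ⟩
  lookup (scaleQ c (toQ β)) k ℚ.+ lookup (lincomb ts) k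
    ≡⟨ cong (ℚ._+ lookup (lincomb ts) k) (lookup-map k (c ℚ.*_) (toQ β)) ⟩
  c ℚ.* lookup (toQ β) k ℚ.+ lookup (lincomb ts) k
    ≡⟨ cong (λ q → c ℚ.* q ℚ.+ lookup (lincomb ts) k) (lookup-toQ β k) ⟩
  c ℚ.* ι (lookup β k) ℚ.+ lookup (lincomb ts) k  ∎

actTerms : ∀ {n} → SignedPerm n → List (ℚ × ZVec n) → List (ℚ × ZVec n)
actTerms ω = List.map (map₂ (act ω))

lookup-lincomb-act : ∀ {n} (ω : SignedPerm n) ts j →
  lookup (lincomb (actTerms ω ts)) j ≡ signQ (sign ω (perm ω ⟨$⟩ˡ j)) (lookup (lincomb ts) (perm ω ⟨$⟩ˡ j))
lookup-lincomb-act ω [] j = begin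
  lookup (lincomb []) j            ≡⟨ lookup-lincomb-[] j ⟩
  0ℚ                               ≡⟨ signQ-0 ε ⟨
  signQ ε 0ℚ                       ≡⟨ cong (signQ ε) (lookup-lincomb-[] i) ⟨
  signQ ε (lookup (lincomb []) i)  ∎
  where
  i = perm ω ⟨$⟩ˡ j
  ε = sign ω i
lookup-lincomb-act ω ((c , β) ∷ ts) j = begin
  lookup (lincomb ((c , act ω β) ∷ actTerms ω ts)) j
    ≡⟨ lookup-lincomb-∷ c (act ω β) (actTerms ω ts) j ⟩
  c ℚ.* ι (lookup (act ω β) j) ℚ.+ lookup (lincomb (actTerms ω ts)) j
    ≡⟨ cong₂ (λ z q → c ℚ.* ι z ℚ.+ q) (lookup-act ω β j) (lookup-lincomb-act ω ts j) ⟩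
  c ℚ.* ι (signZ ε (lookup β i)) ℚ.+ signQ ε (lookup (lincomb ts) i)
    ≡⟨ cong (λ q → c ℚ.* q ℚ.+ signQ ε (lookup (lincomb ts) i)) (ι-signZ ε (lookup β i)) ⟩
  c ℚ.* signQ ε (ι (lookup β i)) ℚ.+ signQ ε (lookup (lincomb ts) i)
    ≡⟨ cong (ℚ._+ signQ ε (lookup (lincomb ts) i)) (signQ-*ʳ ε c (ι (lookup β i))) ⟩
  signQ ε (c ℚ.* ι (lookup β i)) ℚ.+ signQ ε (lookup (lincomb ts) i)
    ≡⟨ signQ-+ ε _ _ ⟨
  signQ ε (c ℚ.* ι (lookup β i) ℚ.+ lookup (lincomb ts) i)
    ≡⟨ cong (signQ ε) (lookup-lincomb-∷ c β ts i) ⟨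
  signQ ε (lookup (lincomb ((c , β) ∷ ts)) i)  ∎
  where
  i = perm ω ⟨$⟩ˡ j
  ε = sign ω i

lincomb-act : ∀ {n} (ω : SignedPerm n) ts α → lincomb ts ≡ toQ α → lincomb (actTerms ω ts) ≡ toQ (act ω α)
lincomb-act ω ts α ts≡α = ≡-from-lookup λ j → let i = perm ω ⟨$⟩ˡ j ; ε = sign ω i in begin
  lookup (lincomb (actTerms ω ts)) j  ≡⟨ lookup-lincomb-act ω ts j ⟩
  signQ ε (lookup (lincomb ts) i)     ≡⟨ cong (λ v → signQ ε (lookup v i)) ts≡α ⟩
  signQ ε (lookup (toQ α) i)          ≡⟨ cong (signQ ε) (lookup-toQ α i) ⟩
  signQ ε (ι (lookup α i))            ≡⟨ ι-signZ ε (lookup α i) ⟨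
  ι (signZ ε (lookup α i))            ≡⟨ cong ι (lookup-act ω α j) ⟨
  ι (lookup (act ω α) j)              ≡⟨ lookup-toQ (act ω α) j ⟨
  lookup (toQ (act ω α)) j            ∎

PLC-self : ∀ {n} {S : Subset n} {α} → InB α → α ∈ₛ S → PLC S α
PLC-self {α = α} α∈B α∈S = α∈B , (1ℚ , α) ∷ [] , (_ , α∈S) ∷ [] , ≡-from-lookup λ k → begin
  lookup (lincomb ((1ℚ , α) ∷ [])) k               ≡⟨ lookup-lincomb-∷ 1ℚ α [] k ⟩
  1ℚ ℚ.* ι (lookup α k) ℚ.+ lookup (lincomb []) k  ≡⟨ cong₂ ℚ._+_ (ℚP.*-identityˡ (ι (lookup α k))) (lookup-lincomb-[] k) ⟩
  ι (lookup α k) ℚ.+ 0ℚ                            ≡⟨ ℚP.+-identityʳ _ ⟩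
  ι (lookup α k)                                   ≡⟨ lookup-toQ α k ⟨
  lookup (toQ α) k                                 ∎

actSet-isSignedPoset : ∀ {n} (ω : SignedPerm n) {P : Subset n} → IsSignedPoset P → IsSignedPoset (actSet ω P)
actSet-isSignedPoset ω {P} SP = record
  { sub     = sub
  ; antisym = λ α α∈ -α∈ → SP.antisym (act ω⁻¹ α) α∈ (subst (λ v → v ∈ₛ P) (act-neg ω⁻¹ α) -α∈)
  ; closedˡ = λ { α (α∈B , ts , ts∈ , ts≡α) → SP.closedˡ (act ω⁻¹ α)
                   (act-InB ω⁻¹ α∈B , actTerms ω⁻¹ ts , map⁺ ts∈ , lincomb-act ω⁻¹ ts α ts≡α) }
  ; closedʳ = λ α α∈ → PLC-self (sub α α∈) α∈
  }
  where
  module SP = IsSignedPoset SP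
  ω⁻¹ = invB ω
  sub : ∀ α → α ∈ₛ actSet ω P → InB α
  sub α α∈ = subst InB (act-act-inv ω α) (act-InB ω (SP.sub (act ω⁻¹ α) α∈))

module _ {A : Set} {_≺_ : A → A → Set} (≺? : ∀ x y → Dec (x ≺ y))
         (≺-irrefl : ∀ {x} → ¬ x ≺ x) (≺-trans : ∀ {x y z} → x ≺ y → y ≺ z → x ≺ z) where

  maximal-above : ∀ x (zs : List A) → ∃[ y ] (y ≡ x ⊎ x ≺ y) × All (λ z → ¬ y ≺ z) (x ∷ zs)
  maximal-above x [] = x , inj₁ refl , ≺-irrefl ∷ []
  maximal-above x (z ∷ zs) with ≺? x z
  ... | yes x≺z with maximal-above z zs
  ...   | y , z≼y , y⊀z ∷ y⊀zs = y , inj₂ x≺y , (λ y≺x → ≺-irrefl (≺-trans x≺y y≺x)) ∷ y⊀z ∷ y⊀zs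
    where
    x≺y : x ≺ y
    x≺y = [ (λ { refl → x≺z }) , ≺-trans x≺z ]′ z≼y
  maximal-above x (z ∷ zs) | no x⊀z with maximal-above x zs
  ...   | y , x≼y , y⊀x ∷ y⊀zs = y , x≼y , y⊀x ∷ y⊀z ∷ y⊀zs
    where
    y⊀z : ¬ y ≺ z
    y⊀z y≺z = x⊀z ([ (λ { refl → y≺z }) , (λ x≺y → ≺-trans x≺y y≺z) ]′ x≼y)

-- The order of a signed poset on signed indices

module _ {n} {Q : Subset n} (SP : IsSignedPoset Q) where
  open IsSignedPoset SP

  combination-closed : ∀ {u v w : ZVec n} a b → Positive a → Positive b → u ∈ₛ Q → v ∈ₛ Q → InB w →
    (∀ k → ι (lookup w k) ≡ a ℚ.* ι (lookup u k) ℚ.+ b ℚ.* ι (lookup v k)) → w ∈ₛ Q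
  combination-closed {u} {v} {w} a b a>0 b>0 u∈Q v∈Q w∈B w≡au+bv =
    closedˡ w (w∈B , (a , u) ∷ (b , v) ∷ [] , (a>0 , u∈Q) ∷ (b>0 , v∈Q) ∷ [] , ≡-from-lookup λ k → begin
      lookup (lincomb ((a , u) ∷ (b , v) ∷ [])) k
        ≡⟨ lookup-lincomb-∷ a u ((b , v) ∷ []) k ⟩
      a ℚ.* ι (lookup u k) ℚ.+ lookup (lincomb ((b , v) ∷ [])) k
        ≡⟨ cong (a ℚ.* ι (lookup u k) ℚ.+_) (lookup-lincomb-∷ b v [] k) ⟩
      a ℚ.* ι (lookup u k) ℚ.+ (b ℚ.* ι (lookup v k) ℚ.+ lookup (lincomb []) k)
        ≡⟨ cong (λ q → a ℚ.* ι (lookup u k) ℚ.+ (b ℚ.* ι (lookup v k) ℚ.+ q)) (lookup-lincomb-[] k) ⟩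
      a ℚ.* ι (lookup u k) ℚ.+ (b ℚ.* ι (lookup v k) ℚ.+ 0ℚ)
        ≡⟨ cong (a ℚ.* ι (lookup u k) ℚ.+_) (ℚP.+-identityʳ _) ⟩
      a ℚ.* ι (lookup u k) ℚ.+ b ℚ.* ι (lookup v k)
        ≡⟨ w≡au+bv k ⟨
      ι (lookup w k)
        ≡⟨ lookup-toQ w k ⟨
      lookup (toQ w) k ∎)

  root-trans : ∀ {x y z : SignedIndex n} → x ≢ y → y ≢ z → x ≢ z →
    root x y ∈ₛ Q → root y z ∈ₛ Q → root x z ∈ₛ Q
  root-trans {x@(i , s)} {y@(j , t)} {z@(k , r)} x≢y y≢z x≢z u∈Q v∈Q = by-index (i ≟ k)
    where
    u v w : Fin n → ℤ
    u l = lookup (root x y) l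
    v l = lookup (root y z) l
    w l = lookup (root x z) l
    by-index : Dec (i ≡ k) → root x z ∈ₛ Q
    by-index (no i≢k) = combination-closed (ι (multiplicity x y)) (ι (multiplicity y z))
        (multiplicity-positive x y) (multiplicity-positive y z) u∈Q v∈Q (InB-root x≢z) λ l → begin
      ι (w l)                     ≡⟨ cong ι (ℤP.*-identityˡ (w l)) ⟨
      ι (+ 1 * w l)               ≡⟨ cong (λ m → ι (m * w l)) (multiplicity-other s r i≢k) ⟨
      ι (multiplicity x z * w l)  ≡⟨ cong ι (root-chain x≢y y≢z x≢z l) ⟩
      ι (multiplicity x y * u l + multiplicity y z * v l)
        ≡⟨ ι-+ (multiplicity x y * u l) (multiplicity y z * v l) ⟩
      ι (multiplicity x y * u l) ℚ.+ ι (multiplicity y z * v l)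
        ≡⟨ cong₂ ℚ._+_ (ι-* (multiplicity x y) (u l)) (ι-* (multiplicity y z) (v l)) ⟩
      ι (multiplicity x y) ℚ.* ι (u l) ℚ.+ ι (multiplicity y z) ℚ.* ι (v l) ∎
    by-index (yes i≡k) = combination-closed ½ ½ _ _ u∈Q v∈Q (InB-root x≢z) λ l → ι-midpoint (u l) (v l) (w l) (begin
      + 2 * w l
        ≡⟨ cong (_* w l) (multiplicity-same s r i≡k) ⟨
      multiplicity x z * w l
        ≡⟨ root-chain x≢y y≢z x≢z l ⟩
      multiplicity x y * u l + multiplicity y z * v l
        ≡⟨ cong₂ (λ a b → a * u l + b * v l) (multiplicity-other s t i≢j) (multiplicity-other t r j≢k) ⟩
      + 1 * u l + + 1 * v l
        ≡⟨ cong₂ _+_ (ℤP.*-identityˡ (u l)) (ℤP.*-identityˡ (v l)) ⟩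
      u l + v l  ∎)
      where
      j≢i : j ≢ i
      j≢i j≡i = no-three-signs-at-one-position i≡k j≡i x≢y y≢z x≢z
      i≢j : i ≢ j
      i≢j i≡j = j≢i (sym i≡j)
      j≢k : j ≢ k
      j≢k j≡k = j≢i (trans j≡k (sym i≡k))

module _ {n} {Q : Subset n} (SP : IsSignedPoset Q) (m : ℕ) where
  open IsSignedPoset SP

  _⊏_ : SignedIndex n → SignedIndex n → Set
  x ⊏ y = toℕ (proj₁ y) ℕ.≤ m × y ≢ x × root y x ∈ₛ Q

  ⊏-trans : ∀ {x y z} → x ⊏ y → y ⊏ z → x ⊏ z
  ⊏-trans {x} {y} {z} (_ , y≢x , yx∈Q) (z≤m , z≢y , zy∈Q) = z≤m , z≢x , root-trans SP z≢y y≢x z≢x zy∈Q yx∈Q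
    where
    z≢x : z ≢ x
    z≢x refl = antisym (root z y) zy∈Q (subst (_∈ₛ Q) (sym (neg-root z≢y)) yx∈Q)

  maximal-position : m ℕ.< n → ∃[ x ] toℕ (proj₁ x) ℕ.≤ m × ∀ y → ¬ x ⊏ y
  maximal-position m<n with maximal-above ⊏? (λ { (_ , x≢x , _) → x≢x refl }) ⊏-trans x₀ (allSignedIndices n)
    where
    x₀ : SignedIndex n
    x₀ = F.fromℕ< m<n , true
    ⊏? : ∀ x y → Dec (x ⊏ y)
    ⊏? x y = toℕ (proj₁ y) ℕ.≤? m ×-dec ¬? (≡-dec _≟_ Bool._≟_ y x) ×-dec T? (Q (root y x))
  ... | x , x₀≼x , x-max = x , [ (λ { refl → ℕP.≤-reflexive (FP.toℕ-fromℕ< m<n) }) , proj₁ ]′ x₀≼x ,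
                            λ y → All.lookup x-max (there (∈-allSignedIndices y))

  maximal-not-negated : ∀ {i s} → (∀ y → ¬ (i , s) ⊏ y) → ∀ α → α ∈ₛ Q →
    (∀ l → m ℕ.< toℕ l → lookup α l ≡ + 0) → lookup α i ≢ signZ (not s) (+ 1)
  maximal-not-negated {i} {s} x-max α α∈Q α-vanishes αi≡-s with root-through (sub α α∈Q) i s αi≡-s
  ... | y , y≢x , root≡α , αy≢0 = x-max y (y≤m , y≢x , subst (_∈ₛ Q) (sym root≡α) α∈Q)
    where
    y≤m : toℕ (proj₁ y) ℕ.≤ m
    y≤m = ℕP.≮⇒≥ λ m<y → αy≢0 (α-vanishes (proj₁ y) m<y)

signZ-unit≡1 : ∀ s {z} → (z ≡ + 0 ⊎ ∃[ b ] z ≡ signZ b (+ 1)) → z ≢ + 0 → z ≢ signZ (not s) (+ 1) → signZ s z ≡ + 1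
signZ-unit≡1 s (inj₁ z≡0) z≢0 _ = contradiction z≡0 z≢0
signZ-unit≡1 s (inj₂ (b , refl)) _ z≢-s with b Bool.≟ s
... | yes refl = signZ-involutive b (+ 1)
... | no  b≢s  = contradiction (cong (λ c → signZ c (+ 1)) (¬-not b≢s)) z≢-s

IsLeading : ∀ {n} → ZVec n → Fin n → Set
IsLeading α k = lookup α k ≢ + 0 × (∀ l → toℕ k ℕ.< toℕ l → lookup α l ≡ + 0)

PositiveLeadingFrom : ∀ {n} → ℕ → Subset n → Set
PositiveLeadingFrom m Q = ∀ α → α ∈ₛ Q → ∀ k → m ℕ.≤ toℕ k → IsLeading α k → lookup α k ≡ + 1

positiveLeading-step : ∀ {n m} {Q : Subset n} → IsSignedPoset Q → m ℕ.< n →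
  PositiveLeadingFrom (suc m) Q → ∃[ τ ] PositiveLeadingFrom m (actSet τ Q)
positiveLeading-step {n} {m} {Q} SP m<n leading with maximal-position SP m m<n
... | (i , s) , i≤m , x-max = moveTo (i , s) m̂ , leading′
  where
  m̂ : Fin n
  m̂ = F.fromℕ< m<n
  τ⁻¹ : ZVec n → ZVec n
  τ⁻¹ = act (invB (moveTo (i , s) m̂))
  unchanged-above : ∀ β l → m ℕ.< toℕ l → lookup (τ⁻¹ β) l ≡ lookup β l
  unchanged-above β l m<l = lookup-moveTo-other s β
    (λ { refl → ℕP.<-irrefl refl (ℕP.≤-<-trans i≤m m<l) })
    (λ { refl → ℕP.<-irrefl (sym (FP.toℕ-fromℕ< m<n)) m<l })
  leading′ : PositiveLeadingFrom m (actSet (moveTo (i , s) m̂) Q)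
  leading′ β β∈ l m≤l (βl≢0 , β-vanishes) with ℕP.m≤n⇒m<n∨m≡n m≤l
  ... | inj₁ m<l = trans (sym (unchanged-above β l m<l)) (leading (τ⁻¹ β) β∈ l m<l
        ( (λ αl≡0 → βl≢0 (trans (sym (unchanged-above β l m<l)) αl≡0))
        , λ l′ l<l′ → trans (unchanged-above β l′ (ℕP.<-trans m<l l<l′)) (β-vanishes l′ l<l′)))
  ... | inj₂ m≡l = begin
    lookup β l            ≡⟨ cong (lookup β) l≡m̂ ⟩
    lookup β m̂           ≡⟨ βm̂≡sαi ⟩
    signZ s (lookup α i)  ≡⟨ signZ-unit≡1 s (InB-coordinate (IsSignedPoset.sub SP α β∈) i) αi≢0 αi≢-s ⟩
    + 1                   ∎
    where
    α = τ⁻¹ β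
    l≡m̂ : l ≡ m̂
    l≡m̂ = FP.toℕ-injective (trans (sym m≡l) (sym (FP.toℕ-fromℕ< m<n)))
    βm̂≡sαi : lookup β m̂ ≡ signZ s (lookup α i)
    βm̂≡sαi = trans (sym (signZ-involutive s (lookup β m̂))) (cong (signZ s) (sym (lookup-moveTo-index i s m̂ β)))
    αi≢0 : lookup α i ≢ + 0
    αi≢0 αi≡0 = βl≢0 (trans (cong (lookup β) l≡m̂) (trans βm̂≡sαi (trans (cong (signZ s) αi≡0) (signZ-0 s))))
    αi≢-s : lookup α i ≢ signZ (not s) (+ 1)
    αi≢-s = maximal-not-negated SP m x-max α β∈ λ p m<p →
      trans (unchanged-above β p m<p) (β-vanishes p (subst (ℕ._< toℕ p) m≡l m<p))

module _ {n} {P : Subset n} (SP : IsSignedPoset P) where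

  positiveLeading-descend : ∀ m → m ℕ.≤ n → (ω : SignedPerm n) → PositiveLeadingFrom m (actSet ω P) →
    ∃[ ω′ ] PositiveLeadingFrom 0 (actSet ω′ P)
  positiveLeading-descend zero    _   ω leading = ω , leading
  positiveLeading-descend (suc m) m<n ω leading with positiveLeading-step (actSet-isSignedPoset ω SP) m<n leading
  ... | τ , leading′ = positiveLeading-descend m (ℕP.<⇒≤ m<n) (τ ∘B ω)
          λ α α∈ → leading′ α (subst (_∈ₛ P) (act-inv-∘B τ ω α) α∈)

positiveLeading-vacuous : ∀ {n} (Q : Subset n) → PositiveLeadingFrom n Q
positiveLeading-vacuous Q α _ k n≤k _ = contradiction (FP.toℕ<n k) (ℕP.≤⇒≯ n≤k)

-- Pairing with (1, …, n)

dot-⊕ : ∀ {n} (v u w : Vec ℤ n) → dot v (u ⊕ w) ≡ dot v u + dot v w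
dot-⊕ []       []       []       = refl
dot-⊕ (x ∷ v) (a ∷ u) (b ∷ w) = begin
  x * (a + b) + dot v (u ⊕ w)
    ≡⟨ cong (λ q → x * (a + b) + q) (dot-⊕ v u w) ⟩
  x * (a + b) + (dot v u + dot v w)
    ≡⟨ solve 5 (λ x a b p q → x :* (a :+ b) :+ (p :+ q) := (x :* a :+ p) :+ (x :* b :+ q)) refl x a b (dot v u) (dot v w) ⟩
  (x * a + dot v u) + (x * b + dot v w)  ∎
  where open +-*-Solver

dot-neg : ∀ {n} (v u : Vec ℤ n) → dot v (neg u) ≡ - dot v u
dot-neg []      []      = refl
dot-neg (x ∷ v) (a ∷ u) = begin
  x * - a + dot v (neg u)  ≡⟨ cong (λ q → x * - a + q) (dot-neg v u) ⟩
  x * - a + - dot v u      ≡⟨ solve 3 (λ x a p → x :* (:- a) :+ (:- p) := :- (x :* a :+ p)) refl x a (dot v u) ⟩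
  - (x * a + dot v u)      ∎
  where open +-*-Solver

dot-zeroʳ : ∀ {n} (v : Vec ℤ n) → dot v (tabulate (λ _ → + 0)) ≡ + 0
dot-zeroʳ []      = refl
dot-zeroʳ (x ∷ v) = cong₂ _+_ (ℤP.*-zeroʳ x) (dot-zeroʳ v)

dot-e : ∀ {n} (v : Vec ℤ n) i → dot v (e i) ≡ lookup v i
dot-e (x ∷ v) F.zero = begin
  x * + 1 + dot v (tabulate (λ _ → + 0))  ≡⟨ cong₂ _+_ (ℤP.*-identityʳ x) (dot-zeroʳ v) ⟩
  x + + 0                                 ≡⟨ ℤP.+-identityʳ x ⟩
  x                                       ∎
dot-e (x ∷ v) (F.suc i) = begin
  x * + 0 + dot v (tail (e (F.suc i)))  ≡⟨ cong₂ _+_ (ℤP.*-zeroʳ x) (cong (dot v) (≡-from-lookup tail-e)) ⟩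
  + 0 + dot v (e i)                     ≡⟨ ℤP.+-identityˡ (dot v (e i)) ⟩
  dot v (e i)                           ≡⟨ dot-e v i ⟩
  lookup v i                            ∎
  where
  tail-e : ∀ k → lookup (e (F.suc i)) (F.suc k) ≡ lookup (e i) k
  tail-e k with i ≟ k
  ... | yes refl = trans (lookup-e-same (F.suc i)) (sym (lookup-e-same i))
  ... | no  i≢k  = trans (lookup-e-other (λ si≡sk → i≢k (FP.suc-injective si≡sk))) (sym (lookup-e-other i≢k))

dot-unit : ∀ {n} (v : Vec ℤ n) i s → dot v (unit (i , s)) ≡ signZ s (lookup v i)
dot-unit v i true  = dot-e v i
dot-unit v i false = trans (dot-neg v (e i)) (cong -_ (dot-e v i))

labels : ∀ {n} → Vec ℤ n
labels = tabulate (value idB)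

dot-labels-unit : ∀ {n} (i : Fin n) s → dot labels (unit (i , s)) ≡ signZ s (+ suc (toℕ i))
dot-labels-unit i s = trans (dot-unit labels i s) (cong (signZ s) (lookup∘tabulate (value idB) i))

unit-leading : ∀ {n} (i : Fin n) s → IsLeading (unit (i , s)) i
unit-leading i s = (λ αi≡0 → signZ-≢0 s (trans (sym (lookup-unit-same i s)) αi≡0))
                 , λ l i<l → lookup-unit-other s (λ { refl → ℕP.<-irrefl refl i<l })

pair-leading : ∀ {n} {i j : Fin n} s t → toℕ i ℕ.< toℕ j → IsLeading (unit (i , s) ⊕ unit (j , t)) j
pair-leading {i = i} {j} s t i<j =
    (λ αj≡0 → signZ-≢0 t (trans (sym (lookup-pair-snd s t (FP.<⇒≢ i<j))) αj≡0))
  , λ l j<l → trans (lookup-⊕ (unit (i , s)) (unit (j , t)) l)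
      (cong₂ _+_ (lookup-unit-other s (λ { refl → ℕP.<-asym i<j j<l })) (proj₂ (unit-leading j t) l j<l))

positiveLeading⇒naturallyLabeled : ∀ {n} {Q : Subset n} → IsSignedPoset Q → PositiveLeadingFrom 0 Q → NaturallyLabeled Q
positiveLeading⇒naturallyLabeled {Q = Q} SP leading α α∈Q = nonnegative (IsSignedPoset.sub SP α α∈Q) α∈Q
  where
  leading-one : ∀ {α k} → α ∈ₛ Q → IsLeading α k → lookup α k ≡ + 1
  leading-one α∈Q = leading _ α∈Q _ ℕ.z≤n
  nonnegative : ∀ {α} → InB α → α ∈ₛ Q → dot labels α ℤ.≥ + 0
  nonnegative (short true i) _ = subst (ℤ._≥ + 0) (sym (dot-labels-unit i true)) (ℤ.+≤+ ℕ.z≤n)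
  nonnegative (short false i) α∈Q
    with () ← trans (sym (lookup-unit-same i false)) (leading-one α∈Q (unit-leading i false))
  nonnegative (long s false i j i<j) α∈Q
    with () ← trans (sym (lookup-pair-snd s false (FP.<⇒≢ i<j))) (leading-one α∈Q (pair-leading s false i<j))
  nonnegative (long s true i j i<j) _ = subst (ℤ._≥ + 0) (sym (trans (dot-⊕ labels (unit (i , s)) (unit (j , true)))
    (cong₂ _+_ (dot-labels-unit i s) (dot-labels-unit j true)))) (sum-nonneg s)
    where
    sum-nonneg : ∀ s → signZ s (+ suc (toℕ i)) + + suc (toℕ j) ℤ.≥ + 0
    sum-nonneg true  = ℤ.+≤+ ℕ.z≤n
    sum-nonneg false = subst (ℤ._≥ + 0) (sym (ℤP.⊖-≥ (ℕP.m≤n⇒m≤1+n i<j))) (ℤ.+≤+ ℕ.z≤n)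

proposition2p19 : (n : ℕ) (P : Subset n) → IsSignedPoset P →
    ∃[ ω ] (IsSignedPoset (actSet ω P) × NaturallyLabeled (actSet ω P))
proposition2p19 n P SP with positiveLeading-descend SP n ℕP.≤-refl idB (positiveLeading-vacuous (actSet idB P))
... | ω , leading = ω , ωP-poset , positiveLeading⇒naturallyLabeled ωP-poset leading
  where
  ωP-poset : IsSignedPoset (actSet ω P)
  ωP-poset = actSet-isSignedPoset ω SP
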